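{- Let $n\ge 1$ and let $\pi$ be a permutation of $[n]=\{1,\dots,n\}$. Let $T_\pi$ be the bipartite graph with vertex set $A\cup B\cup C\cup D$, where $A=\{a_1,\dots,a_n\}$, $B=\{b_1,\dots,b_n\}$, $C=\{c_1,\dots,c_n\}$, $D=\{d_1,\dots,d_n\}$ are pairwise disjoint, and whose edges are exactly: $a_ib_{\pi(i)}$ for each $i\in[n]$; $c_id_j$ for all $i,j\in[n]$; $a_id_j$ for all $1\le j\le i\le n$; and $b_ic_j$ for all $1\le j\le i\le n$. Then $T_\pi$ contains neither $2P_3$ nor $Sun_4$ as an induced subgraph.
   Context: All graphs are finite, simple and undirected. $P_3$ is the chordless path on 3 vertices and $2P_3$ is the disjoint union of two copies of $P_3$. $Sun_4$ is the 8-vertex graph obtained from a chordless 4-cycle by attaching one new pendant vertex (of degree 1) to each of the four cycle vertices. (The graph $T_\pi$ is bipartite with parts $A\cup C$ and $B\cup D$.) -}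

module Defs where

open import Data.Nat using (ℕ)
open import Data.Fin using (Fin; #_; _≤_)
open import Data.Fin.Permutation using (Permutation′; _⟨$⟩ʳ_)
open import Data.Product using (Σ; _×_)
open import Data.Sum using (_⊎_)
open import Function.Definitions using (Injective)
open import Function.Bundles using (_⇔_)
open import Relation.Binary.PropositionalEquality using (_≡_)

record Graph : Set₁ where
  field
    V   : Set
    Adj : V → V → Set
open Graph public

Sym : {X : Set} → (X → X → Set) → X → X → Set
Sym E u v = E u v ⊎ E v u

InducedIn : Graph → Graph → Set
InducedIn H G =
  Σ (V H → V G) λ f →
    Injective _≡_ _≡_ f × (∀ u v → (Adj H u v ⇔ Adj G (f u) (f v)))

data E2P3 : Fin 6 → Fin 6 → Set where
  e01 : E2P3 (# 0) (# 1)
  e12 : E2P3 (# 1) (# 2)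
  e34 : E2P3 (# 3) (# 4)
  e45 : E2P3 (# 4) (# 5)

twoP3 : Graph
twoP3 = record { V = Fin 6 ; Adj = Sym E2P3 }

data ESun4 : Fin 8 → Fin 8 → Set where
  c01 : ESun4 (# 0) (# 1)
  c12 : ESun4 (# 1) (# 2)
  c23 : ESun4 (# 2) (# 3)
  c30 : ESun4 (# 3) (# 0)
  p04 : ESun4 (# 0) (# 4)
  p15 : ESun4 (# 1) (# 5)
  p26 : ESun4 (# 2) (# 6)
  p37 : ESun4 (# 3) (# 7)

sun4 : Graph
sun4 = record { V = Fin 8 ; Adj = Sym ESun4 }

-- Vertices of T_π: a_i, b_i, c_i, d_i (indices 0-based, i : Fin n).
data TV (n : ℕ) : Set where
  a b c d : Fin n → TV n

-- Edges of T_π (one orientation; j ≤ i is the order on Fin n,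
-- which matches the order on [n] under i ↦ i+1).
data TE {n : ℕ} (π : Permutation′ n) : TV n → TV n → Set where
  ab : ∀ i → TE π (a i) (b (π ⟨$⟩ʳ i))
  cd : ∀ i j → TE π (c i) (d j)
  ad : ∀ i j → j ≤ i → TE π (a i) (d j)
  bc : ∀ i j → j ≤ i → TE π (b i) (c j)

T : {n : ℕ} → Permutation′ n → Graph
T {n} π = record { V = TV n ; Adj = Sym (TE π) }

module Submission where

-- Call the vertices of C ∪ D "inner" and those of A ∪ B "outer".  The proof
-- rests on three structural facts about T_π:
--   * C and D are completely joined, and inside C (resp. D) neighbourhoods
--     are nested; hence two non-adjacent inner vertices X, Y never have
--     mutually private neighbours (a neighbour of X missing Y and a
--     neighbour of Y missing X)                               [noMutualPrivate];
--   * an outer vertex has at most one outer neighbour         [uniqueOuterNeighbour];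
--   * T_π is bipartite with C and D on opposite sides, so two inner vertices
--     joined by a path of length 3 are adjacent                [innerAtOddDistance].
-- From the second fact every induced P3 contains an edge with an inner end;
-- two such edges in the two components of an induced 2P3 contradict the
-- first fact.  For Sun4, the three facts together force both vertices of a
-- diagonal pair of the 4-cycle to be inner, and their pendants then
-- contradict the first fact.

open import Defs
open import Data.Nat using (ℕ; _≥_)
open import Data.Fin using (Fin; zero; suc; #_; _≤_; _↑ˡ_; _↑ʳ_)
open import Data.Fin.Properties using (≤-total; ≤-trans)
open import Data.Fin.Permutation using (Permutation′; _⟨$⟩ʳ_; _⟨$⟩ˡ_; inverseˡ)
open import Data.Bool using (Bool; true; false; not)
open import Data.Bool.Properties using (not-involutive)
open import Data.Product using (Σ; _×_; _,_; proj₁; proj₂)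
open import Data.Sum using (inj₁; inj₂; swap)
open import Data.Empty using (⊥; ⊥-elim)
open import Function.Bundles using (Equivalence)
open import Relation.Nullary using (¬_; Dec; yes; no)
open import Relation.Binary.PropositionalEquality
  using (_≡_; _≢_; refl; sym; trans; cong; subst; module ≡-Reasoning)

module Structure {n : ℕ} (π : Permutation′ n) where

  infix 4 _~_
  _~_ : TV n → TV n → Set
  _~_ = Sym (TE π)

  ~-sym : ∀ {u v} → u ~ v → v ~ u
  ~-sym = swap

  data Inner : TV n → Set where
    inC : ∀ i → Inner (c i)
    inD : ∀ i → Inner (d i)

  inner? : ∀ v → Dec (Inner v)
  inner? (a _) = no λ ()
  inner? (b _) = no λ ()
  inner? (c i) = yes (inC i)
  inner? (d i) = yes (inD i)

  Private : TV n → TV n → Set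
  Private X Y = Σ (TV n) λ P → P ~ X × ¬ P ~ Y

  c-antitone : ∀ {i j W} → j ≤ i → W ~ c i → W ~ c j
  c-antitone {j = j} j≤i (inj₁ (bc k _ i≤k)) = inj₁ (bc k j (≤-trans j≤i i≤k))
  c-antitone {j = j} _   (inj₂ (cd _ m))     = inj₂ (cd j m)

  d-antitone : ∀ {i j W} → j ≤ i → W ~ d i → W ~ d j
  d-antitone {j = j} _   (inj₁ (cd k _))     = inj₁ (cd k j)
  d-antitone {j = j} j≤i (inj₁ (ad k _ i≤k)) = inj₁ (ad k j (≤-trans j≤i i≤k))

  -- Non-adjacent inner vertices lie in the same class, where neighbourhoods
  -- are nested; so they cannot both have a private neighbour.
  noMutualPrivate : ∀ {X Y} → Inner X → Inner Y → ¬ X ~ Y →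
                    Private X Y → Private Y X → ⊥
  noMutualPrivate (inC i) (inC j) _ (P , P~X , P≁Y) (Q , Q~Y , Q≁X) with ≤-total i j
  ... | inj₁ i≤j = Q≁X (c-antitone i≤j Q~Y)
  ... | inj₂ j≤i = P≁Y (c-antitone j≤i P~X)
  noMutualPrivate (inD i) (inD j) _ (P , P~X , P≁Y) (Q , Q~Y , Q≁X) with ≤-total i j
  ... | inj₁ i≤j = Q≁X (d-antitone i≤j Q~Y)
  ... | inj₂ j≤i = P≁Y (d-antitone j≤i P~X)
  noMutualPrivate (inC i) (inD j) X≁Y _ _ = X≁Y (inj₁ (cd i j))
  noMutualPrivate (inD i) (inC j) X≁Y _ _ = X≁Y (inj₂ (cd j i))

  outerNeighbourOfA : ∀ {i W} → a i ~ W → ¬ Inner W → W ≡ b (π ⟨$⟩ʳ i)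
  outerNeighbourOfA (inj₁ (ab _))       _  = refl
  outerNeighbourOfA (inj₁ (ad _ j _))   W∉ = ⊥-elim (W∉ (inD j))

  outerNeighbourOfB : ∀ {i W} → b i ~ W → ¬ Inner W → W ≡ a (π ⟨$⟩ˡ i)
  outerNeighbourOfB (inj₁ (bc _ j _)) W∉ = ⊥-elim (W∉ (inC j))
  outerNeighbourOfB (inj₂ (ab k))     _  = cong a (sym (inverseˡ π))

  uniqueOuterNeighbour : ∀ {X W W′} → ¬ Inner X → X ~ W → X ~ W′ →
                         ¬ Inner W → ¬ Inner W′ → W ≡ W′
  uniqueOuterNeighbour {a _} _ e e′ W∉ W′∉ =
    trans (outerNeighbourOfA e W∉) (sym (outerNeighbourOfA e′ W′∉))
  uniqueOuterNeighbour {b _} _ e e′ W∉ W′∉ =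
    trans (outerNeighbourOfB e W∉) (sym (outerNeighbourOfB e′ W′∉))
  uniqueOuterNeighbour {c i} X∉ _ _ _ _ = ⊥-elim (X∉ (inC i))
  uniqueOuterNeighbour {d i} X∉ _ _ _ _ = ⊥-elim (X∉ (inD i))

  side : TV n → Bool
  side (a _) = true
  side (c _) = true
  side (b _) = false
  side (d _) = false

  side-edge : ∀ {u v} → TE π u v → side u ≡ not (side v)
  side-edge (ab _)     = refl
  side-edge (cd _ _)   = refl
  side-edge (ad _ _ _) = refl
  side-edge (bc _ _ _) = refl

  side-adj : ∀ {u v} → u ~ v → side u ≡ not (side v)
  side-adj (inj₁ e) = side-edge e
  side-adj (inj₂ e) = trans (sym (not-involutive _)) (cong not (sym (side-edge e)))

  oppositeInnerAdjacent : ∀ {u v} → Inner u → Inner v → side u ≡ not (side v) → u ~ v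
  oppositeInnerAdjacent (inC i) (inD j) _ = inj₁ (cd i j)
  oppositeInnerAdjacent (inD i) (inC j) _ = inj₂ (cd j i)
  oppositeInnerAdjacent (inC _) (inC _) ()
  oppositeInnerAdjacent (inD _) (inD _) ()

  innerAtOddDistance : ∀ {P X M Y} → P ~ X → X ~ M → M ~ Y →
                       Inner P → Inner Y → P ~ Y
  innerAtOddDistance {P} {X} {M} {Y} P~X X~M M~Y P∈ Y∈ =
    oppositeInnerAdjacent P∈ Y∈ (begin
      side P             ≡⟨ side-adj P~X ⟩
      not (side X)       ≡⟨ cong not (side-adj X~M) ⟩
      not (not (side M)) ≡⟨ not-involutive _ ⟩
      side M             ≡⟨ side-adj M~Y ⟩
      not (side Y)       ∎)
    where open ≡-Reasoning

  record InnerEdgeIn {m : ℕ} (p : Fin m → TV n) : Set where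
    constructor innerEdge
    field
      from to : Fin m
      from-inner : Inner (p from)
      adjacent : p from ~ p to

  -- Every induced P3 p 0 - p 1 - p 2 has an edge with an inner end: otherwise
  -- the outer middle vertex would have two distinct outer neighbours.
  p3InnerEdge : (p : Fin 3 → TV n) → p (# 0) ~ p (# 1) → p (# 1) ~ p (# 2) →
                p (# 0) ≢ p (# 2) → InnerEdgeIn p
  p3InnerEdge p e₀₁ e₁₂ p₀≢p₂ with inner? (p (# 1)) | inner? (p (# 0)) | inner? (p (# 2))
  ... | yes p₁∈ | _      | _      = innerEdge (# 1) (# 0) p₁∈ (~-sym e₀₁)
  ... | no _    | yes p₀∈ | _     = innerEdge (# 0) (# 1) p₀∈ e₀₁
  ... | no _    | no _   | yes p₂∈ = innerEdge (# 2) (# 1) p₂∈ (~-sym e₁₂)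
  ... | no p₁∉  | no p₀∉ | no p₂∉ =
    ⊥-elim (p₀≢p₂ (uniqueOuterNeighbour p₁∉ (~-sym e₀₁) e₁₂ p₀∉ p₂∉))

  middleInner : ∀ {X M Y} → ¬ Inner X → X ~ M → M ~ Y → Private X Y → Inner M
  middleInner {M = M} {Y = Y} X∉ X~M M~Y (P , P~X , P≁Y)
    with inner? M | inner? Y | inner? P
  ... | yes M∈ | _      | _      = M∈
  ... | no M∉  | no Y∉  | _      =
    ⊥-elim (P≁Y (subst (P ~_) (uniqueOuterNeighbour M∉ (~-sym X~M) M~Y X∉ Y∉) P~X))
  ... | no M∉  | yes _  | no P∉  =
    ⊥-elim (P≁Y (subst (_~ Y) (sym (uniqueOuterNeighbour X∉ (~-sym P~X) X~M P∉ M∉)) M~Y))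
  ... | no _   | yes Y∈ | yes P∈ = ⊥-elim (P≁Y (innerAtOddDistance P~X X~M M~Y P∈ Y∈))

  -- A common neighbour of two non-adjacent vertices with mutually private
  -- neighbours is inner: one of the two is outer by noMutualPrivate.
  commonNeighbourInner : ∀ {X M Y} → X ~ M → M ~ Y → ¬ X ~ Y →
                         Private X Y → Private Y X → Inner M
  commonNeighbourInner {X = X} {Y = Y} X~M M~Y X≁Y privX privY with inner? X | inner? Y
  ... | no X∉  | _      = middleInner X∉ X~M M~Y privX
  ... | yes _  | no Y∉  = middleInner Y∉ (~-sym M~Y) (~-sym X~M) privY
  ... | yes X∈ | yes Y∈ = ⊥-elim (noMutualPrivate X∈ Y∈ X≁Y privX privY)

module Induced {H : Graph} {n : ℕ} {π : Permutation′ n} (emb : InducedIn H (T π)) where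
  open Structure π using (_~_)

  f : V H → TV n
  f = proj₁ emb

  adj : ∀ {u v} → Adj H u v → f u ~ f v
  adj {u} {v} = Equivalence.to (proj₂ (proj₂ emb) u v)

  nonadj : ∀ u v → ¬ Adj H u v → ¬ f u ~ f v
  nonadj u v u≁v e = u≁v (Equivalence.from (proj₂ (proj₂ emb) u v) e)

  distinct : ∀ {u v} → u ≢ v → f u ≢ f v
  distinct u≢v e = u≢v (proj₁ (proj₂ emb) e)

pathsSeparated : (k l : Fin 3) → ¬ Sym E2P3 (k ↑ˡ 3) (3 ↑ʳ l)
pathsSeparated zero                _ = λ { (inj₁ ()) ; (inj₂ ()) }
pathsSeparated (suc zero)          _ = λ { (inj₁ ()) ; (inj₂ ()) }
pathsSeparated (suc (suc zero))    _ = λ { (inj₁ ()) ; (inj₂ ()) }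

no2P3 : ∀ {n} (π : Permutation′ n) → ¬ InducedIn twoP3 (T π)
no2P3 π emb =
  edgesInSeparatePaths
    (p3InnerEdge first (adj (inj₁ e01)) (adj (inj₁ e12)) (distinct λ ()))
    (p3InnerEdge second (adj (inj₁ e34)) (adj (inj₁ e45)) (distinct λ ()))
  where
  open Structure π
  open Induced emb

  first second : Fin 3 → TV _
  first k = f (k ↑ˡ 3)
  second l = f (3 ↑ʳ l)

  apart : ∀ k l → ¬ first k ~ second l
  apart k l = nonadj (k ↑ˡ 3) (3 ↑ʳ l) (pathsSeparated k l)

  -- Inner edges in the two paths give non-adjacent inner vertices with
  -- mutually private neighbours.
  edgesInSeparatePaths : InnerEdgeIn first → InnerEdgeIn second → ⊥
  edgesInSeparatePaths (innerEdge k k′ k∈ e) (innerEdge l l′ l∈ e′) =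
    noMutualPrivate k∈ l∈ (apart k l)
      (first k′ , ~-sym e , apart k′ l)
      (second l′ , ~-sym e′ , λ e″ → apart k l′ (~-sym e″))

-- In Sun4 the opposite cycle vertices 0, 2 (and 1, 3) are non-adjacent and
-- have mutually private pendants, so 1 and 3 are inner and contradict noMutualPrivate.
noSun4 : ∀ {n} (π : Permutation′ n) → ¬ InducedIn sun4 (T π)
noSun4 π emb = noMutualPrivate inner₁ inner₃ (nonadj (# 1) (# 3) λ { (inj₁ ()) ; (inj₂ ()) })
  (f (# 5) , adj (inj₂ p15) , nonadj (# 5) (# 3) λ { (inj₁ ()) ; (inj₂ ()) })
  (f (# 7) , adj (inj₂ p37) , nonadj (# 7) (# 1) λ { (inj₁ ()) ; (inj₂ ()) })
  where
  open Structure π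
  open Induced emb
  private₀ : Private (f (# 0)) (f (# 2))
  private₀ = f (# 4) , adj (inj₂ p04) , nonadj (# 4) (# 2) λ { (inj₁ ()) ; (inj₂ ()) }
  private₂ : Private (f (# 2)) (f (# 0))
  private₂ = f (# 6) , adj (inj₂ p26) , nonadj (# 6) (# 0) λ { (inj₁ ()) ; (inj₂ ()) }
  0≁2 : ¬ f (# 0) ~ f (# 2)
  0≁2 = nonadj (# 0) (# 2) λ { (inj₁ ()) ; (inj₂ ()) }
  inner₁ : Inner (f (# 1))
  inner₁ = commonNeighbourInner (adj (inj₁ c01)) (adj (inj₁ c12)) 0≁2 private₀ private₂
  inner₃ : Inner (f (# 3))
  inner₃ = commonNeighbourInner (adj (inj₂ c30)) (adj (inj₂ c23)) 0≁2 private₀ private₂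

mainTheorem7 : (n : ℕ) → n ≥ 1 → (π : Permutation′ n) →
    ¬ InducedIn twoP3 (T π) × ¬ InducedIn sun4 (T π)
mainTheorem7 n _ π = no2P3 π , noSun4 π
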